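{- Let $p<q$ be positive coprime integers. Then: (i) if $q\equiv 1 \pmod p$, $S(p,q)=\frac{p^2+q^2+1}{12pq}+\frac{q}{4}-\frac{p}{12}-\frac{1}{6p}-\frac14$; (ii) if $q\equiv 2 \pmod p$, $S(p,q)=\frac{p^2+q^2+1}{12pq}+\frac{q}{4}-\frac{p}{24}-\frac{5}{24p}-\frac14$; (iii) if $q\equiv 3 \pmod p$, $S(p,q)=\frac{p^2+q^2+1}{12pq}+\frac{q}{4}-\frac{p}{36}-\frac{5}{18p}-\frac13\left\{\frac{p}{3}\right\}-\frac{1}{12}$; (iv) if $q\equiv 4 \pmod p$, $S(p,q)=\frac{p^2+q^2+1}{12pq}+\frac{q}{4}-\frac{p}{48}-\frac{17}{48p}-\frac12\left\{\frac{p}{4}\right\}$.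
   Context: For a real number $x$, $\{x\}=x-\lfloor x\rfloor$ denotes the fractional part, where $\lfloor x\rfloor$ is the greatest integer $\le x$. For an integer $p$ and a positive integer $q$, the Dedekind sum is $S(p,q)=\sum_{r=1}^{q-1}\left\{\frac{r}{q}\right\}\left\{\frac{rp}{q}\right\}$. -}

module Defs where

open import Data.Nat using (ℕ; zero; suc; _∸_)
open import Data.Integer using (ℤ; +_)
import Data.Integer as ℤ
open import Data.Rational using (ℚ; 0ℚ; _+_; _-_; _*_; _/_; floor)
open import Data.List using (List; map; upTo; foldr)

-- Total division of an integer by a natural number, landing in ℚ.
-- (Division by 0 is given the junk value 0; it is only ever used with
-- positive denominators in the statement.)
_÷ℕ_ : ℤ → ℕ → ℚ
n ÷ℕ zero    = 0ℚ
n ÷ℕ (suc d) = n / suc d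

infixl 7 _÷ℕ_

frac : ℚ → ℚ
frac x = x - (floor x / 1)

sumℚ : List ℚ → ℚ
sumℚ = foldr _+_ 0ℚ

dedekind : ℤ → ℕ → ℚ
dedekind p q =
  sumℚ (map (λ r → frac (+ r ÷ℕ q) * frac ((+ r ℤ.* p) ÷ℕ q))
            (map suc (upTo (q ∸ 1))))

-- Write q² S(p,q) as the integer sum D(p,q) = Σ_{r<q} r·(rp mod q) and expand rp mod q = rp − q⌊rp/q⌋.
-- Counting the points (r, j) with 0 ≤ r < q, 1 ≤ j < p, weighted by r, on either side of the line
-- jq = rp relates Σ_r r⌊rp/q⌋ to Σ_j T(⌊jq/p⌋ + 1), T(n) = Σ_{i<n} i; and since j ↦ jq mod p permutes
-- the residues mod p, their power sums are the ordinary ones. Together this yields the reciprocity law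
--   S(p,q) + S(q,p) = (p² + q² + 1)/(12pq) + (p + q)/4 − 3/4.
-- As S(q,p) only depends on q mod p, applying it to (p,q) and to (a,p) when q ≡ a (mod p) gives
--   S(p,q) = (p² + q² + 1)/(12pq) + q/4 − p/(12a) − (a² + 1)/(12ap) − a/4 + S(p,a),
-- and for a ≤ 4 the last term only depends on p mod a.

{-# OPTIONS --safe #-}
module Submission where

open import Defs
open import Data.Nat using (ℕ; _<_; _%_; NonZero)
import Data.Nat as ℕ
open import Data.Nat.Coprimality using (Coprime)
open import Data.Integer using (+_)
open import Data.Rational using (ℚ; _+_; _-_; _*_)
open import Data.Product using (_×_)
open import Relation.Binary.PropositionalEquality using (_≡_)

open import Algebra.Bundles using (CommutativeRing)
import Algebra.Properties.Semiring.Sum as SemiringSum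
open import Data.Bool using (if_then_else_)
open import Data.Empty using (⊥-elim)
open import Data.Fin using (Fin; toℕ; fromℕ<)
open import Data.Fin.Permutation using (Permutation; permutation; _⟨$⟩ʳ_)
open import Data.Fin.Properties using (toℕ<n; toℕ-inject₁; toℕ-fromℕ; toℕ-fromℕ<; toℕ-injective)
import Data.Integer as ℤ
import Data.Integer.DivMod as ℤ
import Data.Integer.Properties as ℤ
import Data.Integer.Tactic.RingSolver as ℤ
open import Data.List using (map; upTo; applyUpTo; _∷_; [])
open import Data.List.Properties using (map-applyUpTo; map-∘)
import Data.Nat.Coprimality as Coprime
open import Data.Nat.Coprimality using (coprime-divisor; coprime-Bézout; ¬0-coprimeTo-2+)
import Data.Nat.DivMod as ℕ
open import Data.Nat.Divisibility using (_∣_; divides; n∣m*n; ∣⇒≤; %-presˡ-∣; ∣n∣m%n⇒∣m)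
open import Data.Nat.GCD using (gcd; gcd[m,n]≢0; n/gcd[m,n]≢0; gcd[m,n]∣m; gcd[m,n]∣n; module Bézout)
import Data.Nat.Properties as ℕ
import Data.Nat.Tactic.RingSolver as ℕ
open import Data.Product using (∃-syntax; _,_)
import Data.Rational as ℚ
open import Data.Rational using (0ℚ; 1ℚ; -_; _/_; 1/_; floor; mkℚ+; toℚᵘ; _≟_)
open import Data.Rational.Literals using (fromℤ)
open import Data.Rational.Properties
  using ( +-*-commutativeRing; +-identityˡ; +-identityʳ; *-identityʳ; *-zeroˡ; *-zeroʳ; *-assoc; *-inverseʳ
        ; ↥p/↧p≡p; /-cong; toℚᵘ-injective; toℚᵘ-fromℚᵘ; toℚᵘ-homo-+; toℚᵘ-homo-* )
open import Data.Rational.Unnormalised as ℚᵘ using (mkℚᵘ; *≡*) renaming (_≃_ to _≃ᵘ_)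
import Data.Rational.Unnormalised.Properties as ℚᵘ
open import Data.Sum using (inj₁; inj₂)
open import Function using (_∘_)
open import Level using (0ℓ)
open import Relation.Binary.PropositionalEquality
  using (refl; sym; trans; cong; cong₂; subst; _≢_; module ≡-Reasoning)
open import Relation.Nullary using (Dec; yes; no; does; ¬_; contradiction)
open import Relation.Nullary.Decidable using (dec-true; dec-false; dec⇒maybe)
open import Tactic.RingSolver using (solve-∀; solve)
open import Tactic.RingSolver.Core.AlmostCommutativeRing using (AlmostCommutativeRing; fromCommutativeRing)

ℚ-ring : AlmostCommutativeRing 0ℓ 0ℓ
ℚ-ring = fromCommutativeRing +-*-commutativeRing (λ x → dec⇒maybe (0ℚ ≟ x))

≡-modulo : ∀ {L R a b : ℚ} k → a ≡ b → L ≡ R + k * (a - b) → L ≡ R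
≡-modulo {R = R} {a} k refl L≡R+k[a-a] = trans L≡R+k[a-a] (algebra R a k)
  where
  algebra : ∀ R a k → R + k * (a - a) ≡ R
  algebra = solve-∀ ℚ-ring

x+y≡z⇒x≡z-y : ∀ {x y z} → x + y ≡ z → x ≡ z - y
x+y≡z⇒x≡z-y {x} {y} refl = algebra x y
  where
  algebra : ∀ x y → x ≡ x + y - y
  algebra = solve-∀ ℚ-ring

*-cancelʳ-≡ : ∀ x y c .{{_ : ℚ.NonZero c}} → x * c ≡ y * c → x ≡ y
*-cancelʳ-≡ x y c xc≡yc = begin
  x                  ≡⟨ *-identityʳ x ⟨
  x * 1ℚ             ≡⟨ cong (x *_) (*-inverseʳ c) ⟨
  x * (c * 1/ c)     ≡⟨ *-assoc x c (1/ c) ⟨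
  x * c * 1/ c       ≡⟨ cong (_* 1/ c) xc≡yc ⟩
  y * c * 1/ c       ≡⟨ *-assoc y c (1/ c) ⟩
  y * (c * 1/ c)     ≡⟨ cong (y *_) (*-inverseʳ c) ⟩
  y * 1ℚ             ≡⟨ *-identityʳ y ⟩
  y                  ∎
  where open ≡-Reasoning

fromℕ : ℕ → ℚ
fromℕ n = fromℤ (+ n)

fromℕ-+ : ∀ m n → fromℕ (m ℕ.+ n) ≡ fromℕ m + fromℕ n
fromℕ-+ m n = trans (sym (↥p/↧p≡p (fromℕ (m ℕ.+ n)))) (/-cong eq refl)
  where
  eq : + (m ℕ.+ n) ≡ + m ℤ.* + 1 ℤ.+ + n ℤ.* + 1
  eq = trans (ℤ.pos-+ m n) (sym (cong₂ ℤ._+_ (ℤ.*-identityʳ (+ m)) (ℤ.*-identityʳ (+ n))))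

fromℕ-* : ∀ m n → fromℕ (m ℕ.* n) ≡ fromℕ m * fromℕ n
fromℕ-* m n = trans (sym (↥p/↧p≡p (fromℕ (m ℕ.* n)))) (/-cong (ℤ.pos-* m n) refl)

toℚᵘ-÷ℕ : ∀ m d → toℚᵘ (+ m ÷ℕ ℕ.suc d) ≃ᵘ mkℚᵘ (+ m) d
toℚᵘ-÷ℕ m d = toℚᵘ-fromℚᵘ (mkℚᵘ (+ m) d)

÷ℕ-cross : ∀ m n d e → m ℕ.* ℕ.suc e ≡ n ℕ.* ℕ.suc d → + m ÷ℕ ℕ.suc d ≡ + n ÷ℕ ℕ.suc e
÷ℕ-cross m n d e eq = toℚᵘ-injective (begin
  toℚᵘ (+ m ÷ℕ ℕ.suc d) ≈⟨ toℚᵘ-÷ℕ m d ⟩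
  mkℚᵘ (+ m) d          ≈⟨ *≡* (trans (sym (ℤ.pos-* m (ℕ.suc e))) (trans (cong +_ eq) (ℤ.pos-* n (ℕ.suc d)))) ⟩
  mkℚᵘ (+ n) e          ≈⟨ ℚᵘ.≃-sym (toℚᵘ-÷ℕ n e) ⟩
  toℚᵘ (+ n ÷ℕ ℕ.suc e) ∎)
  where open ℚᵘ.≃-Reasoning

÷ℕ-*-fromℕ : ∀ m d .{{_ : NonZero d}} → + m ÷ℕ d * fromℕ d ≡ fromℕ m
÷ℕ-*-fromℕ m (ℕ.suc d) = toℚᵘ-injective (begin
  toℚᵘ (+ m ÷ℕ ℕ.suc d * fromℕ (ℕ.suc d))         ≈⟨ toℚᵘ-homo-* (+ m ÷ℕ ℕ.suc d) (fromℕ (ℕ.suc d)) ⟩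
  toℚᵘ (+ m ÷ℕ ℕ.suc d) ℚᵘ.* mkℚᵘ (+ ℕ.suc d) 0 ≈⟨ ℚᵘ.*-congʳ (toℚᵘ-÷ℕ m d) ⟩
  mkℚᵘ (+ m) d ℚᵘ.* mkℚᵘ (+ ℕ.suc d) 0          ≈⟨ *≡* eq ⟩
  mkℚᵘ (+ m) 0                                   ∎)
  where
  open ℚᵘ.≃-Reasoning
  eq : (+ m ℤ.* + ℕ.suc d) ℤ.* + 1 ≡ + m ℤ.* + ℕ.suc (d ℕ.* 1)
  eq rewrite ℕ.*-identityʳ d = ℤ.*-identityʳ (+ m ℤ.* + ℕ.suc d)

÷ℕ-distrib-+ : ∀ m n d → + (m ℕ.+ n) ÷ℕ d ≡ + m ÷ℕ d + + n ÷ℕ d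
÷ℕ-distrib-+ m n ℕ.zero    = refl
÷ℕ-distrib-+ m n (ℕ.suc d) = toℚᵘ-injective (begin
  toℚᵘ (+ (m ℕ.+ n) ÷ℕ D)                       ≈⟨ toℚᵘ-÷ℕ (m ℕ.+ n) d ⟩
  mkℚᵘ (+ (m ℕ.+ n)) d                          ≈⟨ *≡* eq ⟩
  mkℚᵘ (+ m) d ℚᵘ.+ mkℚᵘ (+ n) d                ≈⟨ ℚᵘ.≃-sym (ℚᵘ.+-cong (toℚᵘ-÷ℕ m d) (toℚᵘ-÷ℕ n d)) ⟩
  toℚᵘ (+ m ÷ℕ D) ℚᵘ.+ toℚᵘ (+ n ÷ℕ D)          ≈⟨ ℚᵘ.≃-sym (toℚᵘ-homo-+ (+ m ÷ℕ D) (+ n ÷ℕ D)) ⟩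
  toℚᵘ (+ m ÷ℕ D + + n ÷ℕ D)                    ∎)
  where
  open ℚᵘ.≃-Reasoning
  D : ℕ
  D = ℕ.suc d
  eq : + (m ℕ.+ n) ℤ.* + (D ℕ.* D) ≡ (+ m ℤ.* + D ℤ.+ + n ℤ.* + D) ℤ.* + D
  eq rewrite ℤ.pos-* D D | ℤ.pos-+ m n = ℤ-distrib (+ m) (+ n) (+ D)
    where
    ℤ-distrib : ∀ a b c → (a ℤ.+ b) ℤ.* (c ℤ.* c) ≡ (a ℤ.* c ℤ.+ b ℤ.* c) ℤ.* c
    ℤ-distrib = ℤ.solve-∀

÷ℕ-cancelʳ : ∀ m n k .{{_ : NonZero n}} .{{_ : NonZero k}} → + (m ℕ.* k) ÷ℕ (n ℕ.* k) ≡ + m ÷ℕ n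
÷ℕ-cancelʳ m (ℕ.suc n) (ℕ.suc k) = ÷ℕ-cross (m ℕ.* ℕ.suc k) m (k ℕ.+ n ℕ.* ℕ.suc k) n (ℕ-lemma m (ℕ.suc n) (ℕ.suc k))
  where
  ℕ-lemma : ∀ m n k → m ℕ.* k ℕ.* n ≡ m ℕ.* (n ℕ.* k)
  ℕ-lemma = ℕ.solve-∀

floor-÷ℕ : ∀ n d .{{_ : NonZero d}} → floor (+ n ÷ℕ d) ≡ + (n ℕ./ d)
floor-÷ℕ n d@(ℕ.suc _) = trans (floor-mkℚ+ (n ℕ./ g) (d ℕ./ g)) (cong +_ reduced)
  where
  floor-mkℚ+ : ∀ a b .{{_ : NonZero b}} .{c : Coprime a b} → floor (mkℚ+ a b c) ≡ + (a ℕ./ b)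
  floor-mkℚ+ a b@(ℕ.suc _) = ℤ.div-pos-is-/ℕ (+ a) b
  g : ℕ
  g = gcd n d
  instance
    g≢0 : NonZero g
    g≢0 = ℕ.≢-nonZero (gcd[m,n]≢0 n d (inj₂ (λ ())))
    d/g≢0 : NonZero (d ℕ./ g)
    d/g≢0 = ℕ.≢-nonZero (n/gcd[m,n]≢0 n d)
  reduced : (n ℕ./ g) ℕ./ (d ℕ./ g) ≡ n ℕ./ d
  reduced = begin
    (n ℕ./ g) ℕ./ (d ℕ./ g)                 ≡⟨ ℕ.m*n/o*n≡m/o (n ℕ./ g) g (d ℕ./ g) {{_}} {{d≢0}} ⟨
    (n ℕ./ g ℕ.* g) ℕ./ (d ℕ./ g ℕ.* g)     ≡⟨ ℕ./-congˡ (ℕ.m/n*n≡m (gcd[m,n]∣m n d)) ⟩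
    n ℕ./ (d ℕ./ g ℕ.* g)                   ≡⟨ ℕ./-congʳ (ℕ.m/n*n≡m (gcd[m,n]∣n n d)) ⟩
    n ℕ./ d                                 ∎
    where
    open ≡-Reasoning
    instance
      d≢0 : NonZero (d ℕ./ g ℕ.* g)
      d≢0 = ℕ.≢-nonZero (subst (_≢ 0) (sym (ℕ.m/n*n≡m (gcd[m,n]∣n n d))) (λ ()))

frac-÷ℕ : ∀ n d .{{_ : NonZero d}} → frac (+ n ÷ℕ d) ≡ + (n ℕ.% d) ÷ℕ d
frac-÷ℕ n d = begin
  + n ÷ℕ d - floor (+ n ÷ℕ d) / 1         ≡⟨ cong (λ z → + n ÷ℕ d - z / 1) (floor-÷ℕ n d) ⟩
  + n ÷ℕ d - + k ÷ℕ 1                     ≡⟨ cong (λ m → + m ÷ℕ d - + k ÷ℕ 1) (ℕ.m≡m%n+[m/n]*n n d) ⟩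
  + (r ℕ.+ k ℕ.* d) ÷ℕ d - + k ÷ℕ 1       ≡⟨ cong (_- + k ÷ℕ 1) (÷ℕ-distrib-+ r (k ℕ.* d) d) ⟩
  + r ÷ℕ d + + (k ℕ.* d) ÷ℕ d - + k ÷ℕ 1  ≡⟨ cong (λ z → + r ÷ℕ d + z - + k ÷ℕ 1) integral ⟩
  + r ÷ℕ d + + k ÷ℕ 1 - + k ÷ℕ 1          ≡⟨ x+y≡z⇒x≡z-y refl ⟨
  + r ÷ℕ d                                ∎
  where
  open ≡-Reasoning
  k r : ℕ
  k = n ℕ./ d
  r = n ℕ.% d
  integral : + (k ℕ.* d) ÷ℕ d ≡ + k ÷ℕ 1
  integral = trans (cong (λ e → + (k ℕ.* d) ÷ℕ e) (sym (ℕ.*-identityˡ d))) (÷ℕ-cancelʳ k 1 d)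

frac-*-÷ℕ : ∀ r x n .{{_ : NonZero n}} → frac ((+ r ℤ.* + x) ÷ℕ n) ≡ + ((r ℕ.* x) ℕ.% n) ÷ℕ n
frac-*-÷ℕ r x n = trans (cong (λ z → frac (z ÷ℕ n)) (sym (ℤ.pos-* r x))) (frac-÷ℕ (r ℕ.* x) n)

[m*n]%o≡[m*[n%o]]%o : ∀ r x n .{{_ : NonZero n}} → (r ℕ.* x) ℕ.% n ≡ (r ℕ.* (x ℕ.% n)) ℕ.% n
[m*n]%o≡[m*[n%o]]%o r x n = begin
  (r ℕ.* x) ℕ.% n                           ≡⟨ ℕ.%-distribˡ-* r x n ⟩
  (r ℕ.% n ℕ.* (x ℕ.% n)) ℕ.% n             ≡⟨ cong (λ y → (r ℕ.% n ℕ.* y) ℕ.% n) (ℕ.m%n%n≡m%n x n) ⟨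
  (r ℕ.% n ℕ.* (x ℕ.% n ℕ.% n)) ℕ.% n       ≡⟨ ℕ.%-distribˡ-* r (x ℕ.% n) n ⟨
  (r ℕ.* (x ℕ.% n)) ℕ.% n                   ∎
  where open ≡-Reasoning

fromℕ-*-% : ∀ a b n .{{_ : NonZero n}} →
  fromℕ ((a ℕ.* b) ℕ.% n) ≡ fromℕ a * fromℕ b - fromℕ ((a ℕ.* b) ℕ./ n) * fromℕ n
fromℕ-*-% a b n = x+y≡z⇒x≡z-y (begin
  fromℕ (m ℕ.% n) + fromℕ (m ℕ./ n) * fromℕ n   ≡⟨ cong (_+_ (fromℕ (m ℕ.% n))) (fromℕ-* (m ℕ./ n) n) ⟨
  fromℕ (m ℕ.% n) + fromℕ (m ℕ./ n ℕ.* n)       ≡⟨ fromℕ-+ (m ℕ.% n) (m ℕ./ n ℕ.* n) ⟨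
  fromℕ (m ℕ.% n ℕ.+ m ℕ./ n ℕ.* n)             ≡⟨ cong fromℕ (ℕ.m≡m%n+[m/n]*n m n) ⟨
  fromℕ m                                       ≡⟨ fromℕ-* a b ⟩
  fromℕ a * fromℕ b                             ∎)
  where
  open ≡-Reasoning
  m : ℕ
  m = a ℕ.* b

module ℚ-Sum = SemiringSum (CommutativeRing.semiring +-*-commutativeRing)

∑ : ℕ → (ℕ → ℚ) → ℚ
∑ n f = ℚ-Sum.sum {n} (f ∘ toℕ)

∑-cong : ∀ n {f g : ℕ → ℚ} → (∀ i → i < n → f i ≡ g i) → ∑ n f ≡ ∑ n g
∑-cong n f≗g = ℚ-Sum.sum-cong-≗ {n} (λ i → f≗g (toℕ i) (toℕ<n i))

∑-suc : ∀ n (f : ℕ → ℚ) → ∑ (ℕ.suc n) f ≡ ∑ n f + f n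
∑-suc n f = trans (ℚ-Sum.sum-init-last {n} (f ∘ toℕ))
  (cong₂ _+_ (ℚ-Sum.sum-cong-≗ {n} (cong f ∘ toℕ-inject₁)) (cong f (toℕ-fromℕ n)))

∑-+ : ∀ n (f g : ℕ → ℚ) → ∑ n (λ i → f i + g i) ≡ ∑ n f + ∑ n g
∑-+ n f g = ℚ-Sum.∑-distrib-+ {n} (f ∘ toℕ) (g ∘ toℕ)

∑-comm : ∀ m n (f : ℕ → ℕ → ℚ) → ∑ m (λ i → ∑ n (f i)) ≡ ∑ n (λ j → ∑ m (λ i → f i j))
∑-comm m n f = ℚ-Sum.∑-comm {m} {n} (λ i j → f (toℕ i) (toℕ j))

∑-*ʳ : ∀ n (f : ℕ → ℚ) c → ∑ n (λ i → f i * c) ≡ ∑ n f * c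
∑-*ʳ n f c = sym (ℚ-Sum.*-distribʳ-sum {n} c (f ∘ toℕ))

∑-*ˡ : ∀ n c (f : ℕ → ℚ) → ∑ n (λ i → c * f i) ≡ c * ∑ n f
∑-*ˡ n c f = sym (ℚ-Sum.*-distribˡ-sum {n} c (f ∘ toℕ))

∑-linear₂ : ∀ n a b (f g : ℕ → ℚ) → ∑ n (λ i → a * f i + b * g i) ≡ a * ∑ n f + b * ∑ n g
∑-linear₂ ℕ.zero    a b f g = algebra a b
  where
  algebra : ∀ a b → 0ℚ ≡ a * 0ℚ + b * 0ℚ
  algebra = solve-∀ ℚ-ring
∑-linear₂ (ℕ.suc n) a b f g =
  trans (cong (_+_ (a * f 0 + b * g 0)) (∑-linear₂ n a b (f ∘ ℕ.suc) (g ∘ ℕ.suc))) (algebra a b (f 0) (g 0) _ _)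
  where
  algebra : ∀ a b x y X Y → a * x + b * y + (a * X + b * Y) ≡ a * (x + X) + b * (y + Y)
  algebra = solve-∀ ℚ-ring

∑-linear₃ : ∀ n a b c (f g h : ℕ → ℚ) →
  ∑ n (λ i → a * f i + b * g i + c * h i) ≡ a * ∑ n f + b * ∑ n g + c * ∑ n h
∑-linear₃ ℕ.zero    a b c f g h = algebra a b c
  where
  algebra : ∀ a b c → 0ℚ ≡ a * 0ℚ + b * 0ℚ + c * 0ℚ
  algebra = solve-∀ ℚ-ring
∑-linear₃ (ℕ.suc n) a b c f g h =
  trans (cong (_+_ (a * f 0 + b * g 0 + c * h 0)) (∑-linear₃ n a b c (f ∘ ℕ.suc) (g ∘ ℕ.suc) (h ∘ ℕ.suc)))
        (algebra a b c (f 0) (g 0) (h 0) _ _ _)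
  where
  algebra : ∀ a b c x y z X Y Z →
    a * x + b * y + c * z + (a * X + b * Y + c * Z) ≡ a * (x + X) + b * (y + Y) + c * (z + Z)
  algebra = solve-∀ ℚ-ring

∑-const : ∀ n c → ∑ n (λ _ → c) ≡ fromℕ n * c
∑-const ℕ.zero    c = sym (*-zeroˡ c)
∑-const (ℕ.suc n) c = begin
  c + ∑ n (λ _ → c)    ≡⟨ cong (_+_ c) (∑-const n c) ⟩
  c + fromℕ n * c      ≡⟨ algebra c (fromℕ n) ⟩
  (1ℚ + fromℕ n) * c   ≡⟨ cong (_* c) (fromℕ-+ 1 n) ⟨
  fromℕ (ℕ.suc n) * c  ∎
  where
  open ≡-Reasoning
  algebra : ∀ c N → c + N * c ≡ (1ℚ + N) * c
  algebra = solve-∀ ℚ-ring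

sumℚ-upTo : ∀ n (f : ℕ → ℚ) → sumℚ (map f (upTo n)) ≡ ∑ n f
sumℚ-upTo n f = trans (cong sumℚ (map-applyUpTo (λ i → i) f n)) (sumℚ-applyUpTo n f)
  where
  sumℚ-applyUpTo : ∀ n (f : ℕ → ℚ) → sumℚ (applyUpTo f n) ≡ ∑ n f
  sumℚ-applyUpTo ℕ.zero    f = refl
  sumℚ-applyUpTo (ℕ.suc n) f = cong (_+_ (f 0)) (sumℚ-applyUpTo n (f ∘ ℕ.suc))

mod-inverse : ∀ p q .{{_ : NonZero p}} → Coprime p q → ∃[ c ] (q ℕ.* c) ℕ.% p ≡ 1 ℕ.% p
mod-inverse p@(ℕ.suc p′) q coprime with coprime-Bézout coprime
... | Bézout.-+ x y eq = y , (begin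
  (q ℕ.* y) ℕ.% p           ≡⟨ cong (ℕ._% p) (trans (ℕ.*-comm q y) (sym eq)) ⟩
  (1 ℕ.+ x ℕ.* p) ℕ.% p     ≡⟨ ℕ.[m+kn]%n≡m%n 1 x p ⟩
  1 ℕ.% p                   ∎)
  where open ≡-Reasoning
... | Bézout.+- x y eq = p′ ℕ.* y , (begin
  (q ℕ.* (p′ ℕ.* y)) ℕ.% p         ≡⟨ ℕ.[m+n]%n≡m%n (q ℕ.* (p′ ℕ.* y)) p ⟨
  (q ℕ.* (p′ ℕ.* y) ℕ.+ p) ℕ.% p   ≡⟨ cong (ℕ._% p) shifted ⟩
  (1 ℕ.+ p′ ℕ.* x ℕ.* p) ℕ.% p     ≡⟨ ℕ.[m+kn]%n≡m%n 1 (p′ ℕ.* x) p ⟩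
  1 ℕ.% p                          ∎)
  where
  open ≡-Reasoning
  rearrange : ∀ q p′ y → q ℕ.* (p′ ℕ.* y) ℕ.+ ℕ.suc p′ ≡ 1 ℕ.+ p′ ℕ.* (1 ℕ.+ y ℕ.* q)
  rearrange = ℕ.solve-∀
  shifted : q ℕ.* (p′ ℕ.* y) ℕ.+ p ≡ 1 ℕ.+ p′ ℕ.* x ℕ.* p
  shifted = trans (rearrange q p′ y) (cong (λ z → 1 ℕ.+ z) (trans (cong (p′ ℕ.*_) eq) (sym (ℕ.*-assoc p′ x p))))

∑-permute-mod : ∀ p q .{{_ : NonZero p}} → Coprime p q → (f : ℕ → ℚ) →
  ∑ p (λ j → f ((j ℕ.* q) ℕ.% p)) ≡ ∑ p f
∑-permute-mod p q coprime f with c , qc≡1 ← mod-inverse p q coprime = begin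
  ∑ p (λ j → f ((j ℕ.* q) ℕ.% p))              ≡⟨ ℚ-Sum.sum-cong-≗ {p} (λ i → cong f (sym (toℕ-fromℕ< _))) ⟩
  ℚ-Sum.sum {p} (λ i → f (toℕ (π ⟨$⟩ʳ i)))     ≡⟨ ℚ-Sum.sum-permute (f ∘ toℕ) π ⟨
  ∑ p f                                        ∎
  where
  open ≡-Reasoning
  times : ℕ → Fin p → Fin p
  times k i = fromℕ< (ℕ.m%n<n (toℕ i ℕ.* k) p)
  undo : ∀ k k′ → (k ℕ.* k′) ℕ.% p ≡ 1 ℕ.% p → ∀ i → times k′ (times k i) ≡ i
  undo k k′ kk′≡1 i = toℕ-injective (begin
    toℕ (times k′ (times k i))               ≡⟨ toℕ-fromℕ< _ ⟩
    (toℕ (times k i) ℕ.* k′) ℕ.% p           ≡⟨ cong (λ z → (z ℕ.* k′) ℕ.% p) (toℕ-fromℕ< (ℕ.m%n<n (toℕ i ℕ.* k) p)) ⟩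
    ((toℕ i ℕ.* k) ℕ.% p ℕ.* k′) ℕ.% p       ≡⟨ cong (ℕ._% p) (ℕ.*-comm ((toℕ i ℕ.* k) ℕ.% p) k′) ⟩
    (k′ ℕ.* ((toℕ i ℕ.* k) ℕ.% p)) ℕ.% p     ≡⟨ [m*n]%o≡[m*[n%o]]%o k′ (toℕ i ℕ.* k) p ⟨
    (k′ ℕ.* (toℕ i ℕ.* k)) ℕ.% p             ≡⟨ cong (ℕ._% p) (regroup k′ (toℕ i) k) ⟩
    (toℕ i ℕ.* (k ℕ.* k′)) ℕ.% p             ≡⟨ [m*n]%o≡[m*[n%o]]%o (toℕ i) (k ℕ.* k′) p ⟩
    (toℕ i ℕ.* ((k ℕ.* k′) ℕ.% p)) ℕ.% p     ≡⟨ cong (λ z → (toℕ i ℕ.* z) ℕ.% p) kk′≡1 ⟩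
    (toℕ i ℕ.* (1 ℕ.% p)) ℕ.% p              ≡⟨ [m*n]%o≡[m*[n%o]]%o (toℕ i) 1 p ⟨
    (toℕ i ℕ.* 1) ℕ.% p                      ≡⟨ cong (ℕ._% p) (ℕ.*-identityʳ (toℕ i)) ⟩
    toℕ i ℕ.% p                              ≡⟨ ℕ.m<n⇒m%n≡m (toℕ<n i) ⟩
    toℕ i                                    ∎)
    where
    regroup : ∀ k′ i k → k′ ℕ.* (i ℕ.* k) ≡ i ℕ.* (k ℕ.* k′)
    regroup = ℕ.solve-∀
  π : Permutation p p
  π = permutation (times q) (times c) (undo c q (trans (cong (ℕ._% p) (ℕ.*-comm c q)) qc≡1)) (undo q c qc≡1)

∑i : ℕ → ℚ
∑i n = ∑ n fromℕ

∑i² : ℕ → ℚ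
∑i² n = ∑ n (λ i → fromℕ i * fromℕ i)

∑i-closed : ∀ n → ∑i n ≡ + 1 ÷ℕ 2 * (fromℕ n * fromℕ n - fromℕ n)
∑i-closed ℕ.zero    = refl
∑i-closed (ℕ.suc n) = begin
  ∑i (ℕ.suc n)                      ≡⟨ ∑-suc n fromℕ ⟩
  ∑i n + N                          ≡⟨ cong (_+ N) (∑i-closed n) ⟩
  + 1 ÷ℕ 2 * (N * N - N) + N        ≡⟨ algebra N ⟩
  + 1 ÷ℕ 2 * (M * M - M)            ≡⟨ cong (λ M → + 1 ÷ℕ 2 * (M * M - M)) (fromℕ-+ 1 n) ⟨
  + 1 ÷ℕ 2 * (fromℕ (ℕ.suc n) * fromℕ (ℕ.suc n) - fromℕ (ℕ.suc n)) ∎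
  where
  open ≡-Reasoning
  N M : ℚ
  N = fromℕ n
  M = 1ℚ + N
  algebra : ∀ N → + 1 ÷ℕ 2 * (N * N - N) + N ≡ + 1 ÷ℕ 2 * ((1ℚ + N) * (1ℚ + N) - (1ℚ + N))
  algebra = solve-∀ ℚ-ring

∑i²-closed : ∀ n → ∑i² n ≡ + 1 ÷ℕ 6 * (fromℕ 2 * (fromℕ n * fromℕ n * fromℕ n) - fromℕ 3 * (fromℕ n * fromℕ n) + fromℕ n)
∑i²-closed ℕ.zero    = refl
∑i²-closed (ℕ.suc n) = begin
  ∑i² (ℕ.suc n)                     ≡⟨ ∑-suc n (λ i → fromℕ i * fromℕ i) ⟩
  ∑i² n + N * N                     ≡⟨ cong (_+ N * N) (∑i²-closed n) ⟩
  cubic N + N * N                   ≡⟨ algebra N ⟩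
  cubic (1ℚ + N)                    ≡⟨ cong cubic (fromℕ-+ 1 n) ⟨
  cubic (fromℕ (ℕ.suc n))           ∎
  where
  open ≡-Reasoning
  N : ℚ
  N = fromℕ n
  cubic : ℚ → ℚ
  cubic N = + 1 ÷ℕ 6 * (fromℕ 2 * (N * N * N) - fromℕ 3 * (N * N) + N)
  algebra : ∀ N → + 1 ÷ℕ 6 * (fromℕ 2 * (N * N * N) - fromℕ 3 * (N * N) + N) + N * N
                 ≡ + 1 ÷ℕ 6 * (fromℕ 2 * ((1ℚ + N) * (1ℚ + N) * (1ℚ + N)) - fromℕ 3 * ((1ℚ + N) * (1ℚ + N)) + (1ℚ + N))
  algebra = solve-∀ ℚ-ring

∑-∑i-suc : ∀ n (g : ℕ → ℕ) →
  ∑ n (λ j → ∑i (ℕ.suc (g j))) ≡ + 1 ÷ℕ 2 * ∑ n (λ j → fromℕ (g j) * fromℕ (g j)) + + 1 ÷ℕ 2 * ∑ n (fromℕ ∘ g)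
∑-∑i-suc n g = trans (∑-cong n (λ j _ → triangle (g j))) (∑-linear₂ n (+ 1 ÷ℕ 2) (+ 1 ÷ℕ 2) (λ j → fromℕ (g j) * fromℕ (g j)) (fromℕ ∘ g))
  where
  algebra : ∀ G → + 1 ÷ℕ 2 * ((1ℚ + G) * (1ℚ + G) - (1ℚ + G)) ≡ + 1 ÷ℕ 2 * (G * G) + + 1 ÷ℕ 2 * G
  algebra = solve-∀ ℚ-ring
  triangle : ∀ m → ∑i (ℕ.suc m) ≡ + 1 ÷ℕ 2 * (fromℕ m * fromℕ m) + + 1 ÷ℕ 2 * fromℕ m
  triangle m = trans (∑i-closed (ℕ.suc m)) (trans (cong (λ M → + 1 ÷ℕ 2 * (M * M - M)) (fromℕ-+ 1 m)) (algebra (fromℕ m)))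

-- Dedekind sums as integer sums

dedekind-∑ : ∀ x n → dedekind (+ x) n ≡
  ∑ (n ℕ.∸ 1) (λ r → frac (+ ℕ.suc r ÷ℕ n) * frac ((+ ℕ.suc r ℤ.* + x) ÷ℕ n))
dedekind-∑ x n = trans (cong sumℚ (sym (map-∘ (upTo (n ℕ.∸ 1))))) (sumℚ-upTo (n ℕ.∸ 1) _)

dedekind-mod : ∀ x n .{{_ : NonZero n}} → dedekind (+ x) n ≡ dedekind (+ (x ℕ.% n)) n
dedekind-mod x n = begin
  dedekind (+ x) n                 ≡⟨ dedekind-∑ x n ⟩
  ∑ (n ℕ.∸ 1) (term x)             ≡⟨ ∑-cong (n ℕ.∸ 1) (λ r _ → cong (frac (+ ℕ.suc r ÷ℕ n) *_) (residue r)) ⟩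
  ∑ (n ℕ.∸ 1) (term (x ℕ.% n))     ≡⟨ dedekind-∑ (x ℕ.% n) n ⟨
  dedekind (+ (x ℕ.% n)) n         ∎
  where
  open ≡-Reasoning
  term : ℕ → ℕ → ℚ
  term y r = frac (+ ℕ.suc r ÷ℕ n) * frac ((+ ℕ.suc r ℤ.* + y) ÷ℕ n)
  residue : ∀ r → frac ((+ ℕ.suc r ℤ.* + x) ÷ℕ n) ≡ frac ((+ ℕ.suc r ℤ.* + (x ℕ.% n)) ÷ℕ n)
  residue r = begin
    frac ((+ ℕ.suc r ℤ.* + x) ÷ℕ n)              ≡⟨ frac-*-÷ℕ (ℕ.suc r) x n ⟩
    + ((ℕ.suc r ℕ.* x) ℕ.% n) ÷ℕ n               ≡⟨ cong (λ m → + m ÷ℕ n) ([m*n]%o≡[m*[n%o]]%o (ℕ.suc r) x n) ⟩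
    + ((ℕ.suc r ℕ.* (x ℕ.% n)) ℕ.% n) ÷ℕ n       ≡⟨ frac-*-÷ℕ (ℕ.suc r) (x ℕ.% n) n ⟨
    frac ((+ ℕ.suc r ℤ.* + (x ℕ.% n)) ÷ℕ n)      ∎

dedekindNumerator : (x n : ℕ) .{{_ : NonZero n}} → ℚ
dedekindNumerator x n = ∑ n (λ r → fromℕ r * fromℕ ((r ℕ.* x) ℕ.% n))

dedekind-numerator : ∀ x n .{{_ : NonZero n}} →
  dedekind (+ x) n * (fromℕ n * fromℕ n) ≡ dedekindNumerator x n
dedekind-numerator x n@(ℕ.suc n′) = begin
  dedekind (+ x) n * (N * N)                              ≡⟨ cong (_* (N * N)) (dedekind-∑ x n) ⟩
  ∑ n′ (λ r → term (ℕ.suc r)) * (N * N)                   ≡⟨ ∑-*ʳ n′ (term ∘ ℕ.suc) (N * N) ⟨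
  ∑ n′ (λ r → term (ℕ.suc r) * (N * N))                   ≡⟨ ∑-cong n′ (λ r r<n′ → cleared (ℕ.suc r) (ℕ.s≤s r<n′)) ⟩
  ∑ n′ (λ r → summand (ℕ.suc r))                          ≡⟨ +-identityˡ _ ⟨
  0ℚ + ∑ n′ (λ r → summand (ℕ.suc r))                     ≡⟨ cong (_+ ∑ n′ (summand ∘ ℕ.suc)) (*-zeroˡ (fromℕ (x ℕ.% n))) ⟨
  dedekindNumerator x n                                   ∎
  where
  open ≡-Reasoning
  N : ℚ
  N = fromℕ n
  term summand : ℕ → ℚ
  term r = frac (+ r ÷ℕ n) * frac ((+ r ℤ.* + x) ÷ℕ n)
  summand r = fromℕ r * fromℕ ((r ℕ.* x) ℕ.% n)
  algebra : ∀ a b N → a * b * (N * N) ≡ (a * N) * (b * N)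
  algebra = solve-∀ ℚ-ring
  cleared : ∀ r → r < n → term r * (N * N) ≡ summand r
  cleared r r<n = begin
    term r * (N * N)                                      ≡⟨ cong₂ (λ a b → a * b * (N * N))
                                                               (trans (frac-÷ℕ r n) (cong (λ m → + m ÷ℕ n) (ℕ.m<n⇒m%n≡m r<n)))
                                                               (frac-*-÷ℕ r x n) ⟩
    (+ r ÷ℕ n) * (+ ((r ℕ.* x) ℕ.% n) ÷ℕ n) * (N * N)     ≡⟨ algebra (+ r ÷ℕ n) (+ ((r ℕ.* x) ℕ.% n) ÷ℕ n) N ⟩
    (+ r ÷ℕ n * N) * (+ ((r ℕ.* x) ℕ.% n) ÷ℕ n * N)       ≡⟨ cong₂ _*_ (÷ℕ-*-fromℕ r n) (÷ℕ-*-fromℕ _ n) ⟩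
    summand r                                             ∎

dedekindNumerator-floor : ∀ x n .{{_ : NonZero n}} →
  dedekindNumerator x n ≡ fromℕ x * ∑i² n - fromℕ n * ∑ n (λ r → fromℕ r * fromℕ ((r ℕ.* x) ℕ./ n))
dedekindNumerator-floor x n = begin
  dedekindNumerator x n                                         ≡⟨ ∑-cong n (λ r _ → expand r) ⟩
  ∑ n (λ r → X * (fromℕ r * fromℕ r) + (- N) * (fromℕ r * F r)) ≡⟨ ∑-linear₂ n X (- N) (λ r → fromℕ r * fromℕ r) (λ r → fromℕ r * F r) ⟩
  X * ∑i² n + (- N) * ∑ n (λ r → fromℕ r * F r)                  ≡⟨ algebra X N (∑i² n) _ ⟩
  X * ∑i² n - N * ∑ n (λ r → fromℕ r * F r)                      ∎
  where
  open ≡-Reasoning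
  X N : ℚ
  X = fromℕ x
  N = fromℕ n
  F : ℕ → ℚ
  F r = fromℕ ((r ℕ.* x) ℕ./ n)
  expand : ∀ r → fromℕ r * fromℕ ((r ℕ.* x) ℕ.% n) ≡ X * (fromℕ r * fromℕ r) + (- N) * (fromℕ r * F r)
  expand r = trans (cong (fromℕ r *_) (fromℕ-*-% r x n)) (regroup (fromℕ r) X N (F r))
    where
    regroup : ∀ R X N F → R * (R * X - F * N) ≡ X * (R * R) + (- N) * (R * F)
    regroup = solve-∀ ℚ-ring
  algebra : ∀ X N S T → X * S + (- N) * T ≡ X * S - N * T
  algebra = solve-∀ ℚ-ring

-- Counting lattice points

𝟙 : {A : Set} → Dec A → ℚ
𝟙 A? = if does A? then 1ℚ else 0ℚ

𝟙-yes : {A : Set} (A? : Dec A) → A → 𝟙 A? ≡ 1ℚ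
𝟙-yes A? a = cong (if_then 1ℚ else 0ℚ) (dec-true A? a)

𝟙-no : {A : Set} (A? : Dec A) → ¬ A → 𝟙 A? ≡ 0ℚ
𝟙-no A? ¬a = cong (if_then 1ℚ else 0ℚ) (dec-false A? ¬a)

𝟙-cong : {A B : Set} (A? : Dec A) (B? : Dec B) → (A → B) → (B → A) → 𝟙 A? ≡ 𝟙 B?
𝟙-cong A? B? A→B B→A with A? | B?
... | yes _ | yes _ = refl
... | no _  | no _  = refl
... | yes a | no ¬b = contradiction (A→B a) ¬b
... | no ¬a | yes b = contradiction (B→A b) ¬a

∑-𝟙-< : ∀ n D → D ℕ.≤ n → ∑ n (λ j → 𝟙 (j ℕ.<? D)) ≡ fromℕ D
∑-𝟙-< n         ℕ.zero    _             = ℚ-Sum.sum-replicate-zero n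
∑-𝟙-< (ℕ.suc n) (ℕ.suc D) (ℕ.s≤s D≤n) =
  trans (cong (_+_ 1ℚ) (∑-𝟙-< n D D≤n)) (sym (fromℕ-+ 1 D))

∑i-split : ∀ h q → h < q → ∑ q (λ r → fromℕ r * 𝟙 (h ℕ.<? r)) + ∑i (ℕ.suc h) ≡ ∑i q
∑i-split h (ℕ.suc q) h<1+q with ℕ.m<1+n⇒m<n∨m≡n h<1+q
... | inj₁ h<q = begin
  ∑ (ℕ.suc q) f + ∑i (ℕ.suc h)                  ≡⟨ cong (_+ ∑i (ℕ.suc h)) (∑-suc q f) ⟩
  ∑ q f + fromℕ q * 𝟙 (h ℕ.<? q) + ∑i (ℕ.suc h) ≡⟨ cong (λ x → ∑ q f + fromℕ q * x + ∑i (ℕ.suc h)) (𝟙-yes (h ℕ.<? q) h<q) ⟩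
  ∑ q f + fromℕ q * 1ℚ + ∑i (ℕ.suc h)           ≡⟨ algebra (∑ q f) (fromℕ q) (∑i (ℕ.suc h)) ⟩
  ∑ q f + ∑i (ℕ.suc h) + fromℕ q                ≡⟨ cong (_+ fromℕ q) (∑i-split h q h<q) ⟩
  ∑i q + fromℕ q                                ≡⟨ ∑-suc q fromℕ ⟨
  ∑i (ℕ.suc q)                                  ∎
  where
  open ≡-Reasoning
  f : ℕ → ℚ
  f r = fromℕ r * 𝟙 (h ℕ.<? r)
  algebra : ∀ S Q T → S + Q * 1ℚ + T ≡ S + T + Q
  algebra = solve-∀ ℚ-ring
... | inj₂ refl = begin
  ∑ (ℕ.suc h) f + ∑i (ℕ.suc h)                  ≡⟨ cong (_+ ∑i (ℕ.suc h)) (∑-cong (ℕ.suc h) none) ⟩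
  ∑ (ℕ.suc h) (λ _ → 0ℚ) + ∑i (ℕ.suc h)         ≡⟨ cong (_+ ∑i (ℕ.suc h)) (ℚ-Sum.sum-replicate-zero (ℕ.suc h)) ⟩
  0ℚ + ∑i (ℕ.suc h)                             ≡⟨ +-identityˡ _ ⟩
  ∑i (ℕ.suc h)                                  ∎
  where
  open ≡-Reasoning
  f : ℕ → ℚ
  f r = fromℕ r * 𝟙 (h ℕ.<? r)
  none : ∀ r → r < ℕ.suc h → f r ≡ 0ℚ
  none r r<1+h = trans (cong (fromℕ r *_) (𝟙-no (h ℕ.<? r) (ℕ.≤⇒≯ (ℕ.s≤s⁻¹ r<1+h)))) (*-zeroʳ (fromℕ r))

m/n<o⇒m<o*n : ∀ {m n o} .{{_ : NonZero n}} → m ℕ./ n < o → m < o ℕ.* n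
m/n<o⇒m<o*n {m} {n} {o} m/n<o = begin-strict
  m                              ≡⟨ ℕ.m≡m%n+[m/n]*n m n ⟩
  m ℕ.% n ℕ.+ (m ℕ./ n) ℕ.* n    <⟨ ℕ.+-monoˡ-< ((m ℕ./ n) ℕ.* n) (ℕ.m%n<n m n) ⟩
  ℕ.suc (m ℕ./ n) ℕ.* n          ≤⟨ ℕ.*-monoˡ-≤ n m/n<o ⟩
  o ℕ.* n                        ∎
  where open ℕ.≤-Reasoning

floor-as-count : ∀ p′ q r .{{_ : NonZero q}} → Coprime (ℕ.suc p′) q → r < q →
  fromℕ ((r ℕ.* ℕ.suc p′) ℕ./ q) ≡ ∑ p′ (λ j → 𝟙 ((ℕ.suc j ℕ.* q) ℕ./ ℕ.suc p′ ℕ.<? r))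
floor-as-count p′ q r coprime r<q =
  trans (sym (∑-𝟙-< p′ ((r ℕ.* p) ℕ./ q) (ℕ.s≤s⁻¹ (ℕ.m<n*o⇒m/o<n rp<pq))))
        (∑-cong p′ (λ j j<p′ → 𝟙-cong (j ℕ.<? (r ℕ.* p) ℕ./ q) (h (ℕ.suc j) ℕ.<? r) (to j j<p′) (from j)))
  where
  p : ℕ
  p = ℕ.suc p′
  h : ℕ → ℕ
  h j = (j ℕ.* q) ℕ./ p
  rp<pq : r ℕ.* p < p ℕ.* q
  rp<pq = subst (r ℕ.* p <_) (ℕ.*-comm q p) (ℕ.*-monoˡ-< p r<q)
  off-lattice : ∀ j → j < p′ → ℕ.suc j ℕ.* q ≢ r ℕ.* p
  off-lattice j j<p′ eq = ℕ.<⇒≱ (ℕ.s≤s j<p′)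
    (∣⇒≤ (coprime-divisor coprime (subst (p ∣_) (trans (sym eq) (ℕ.*-comm (ℕ.suc j) q)) (n∣m*n r))))
  to : ∀ j → j < p′ → j < (r ℕ.* p) ℕ./ q → h (ℕ.suc j) < r
  to j j<p′ j<rp/q = ℕ.m<n*o⇒m/o<n (ℕ.≤∧≢⇒< (ℕ.≮⇒≥ (λ rp<q+jq → ℕ.<⇒≱ (ℕ.m<n*o⇒m/o<n rp<q+jq) j<rp/q))
                                            (off-lattice j j<p′))
  from : ∀ j → h (ℕ.suc j) < r → j < (r ℕ.* p) ℕ./ q
  from j h<r = ℕ.≰⇒> (λ rp/q≤j → ℕ.<⇒≱ (m/n<o⇒m<o*n h<r) (ℕ.<⇒≤ (m/n<o⇒m<o*n (ℕ.s≤s rp/q≤j))))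

-- Both sides weight the pairs (r, j) with r < q and 1 ≤ j < p by r: the first sum counts those
-- with jq < rp, the second (through ∑i-split) those with rp < jq.
lattice-count : ∀ p′ q .{{_ : NonZero q}} → Coprime (ℕ.suc p′) q →
  ∑ q (λ r → fromℕ r * fromℕ ((r ℕ.* ℕ.suc p′) ℕ./ q))
    + ∑ (ℕ.suc p′) (λ j → ∑i (ℕ.suc ((j ℕ.* q) ℕ./ ℕ.suc p′)))
  ≡ fromℕ p′ * ∑i q
lattice-count p′ q coprime = begin
  ∑ q (λ r → fromℕ r * fromℕ ((r ℕ.* p) ℕ./ q)) + ∑ p (λ j → ∑i (ℕ.suc (h j)))
    ≡⟨ cong₂ _+_ (∑-cong q (λ r r<q → cong (fromℕ r *_) (floor-as-count p′ q r coprime r<q))) (+-identityˡ _) ⟩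
  ∑ q (λ r → fromℕ r * ∑ p′ (λ j → below j r)) + B′
    ≡⟨ cong (_+ B′) (trans (∑-cong q (λ r _ → sym (∑-*ˡ p′ (fromℕ r) (λ j → below j r))))
                           (∑-comm q p′ (λ r j → fromℕ r * below j r))) ⟩
  ∑ p′ (λ j → ∑ q (λ r → fromℕ r * below j r)) + B′
    ≡⟨ ∑-+ p′ (λ j → ∑ q (λ r → fromℕ r * below j r)) (λ j → ∑i (ℕ.suc (h (ℕ.suc j)))) ⟨
  ∑ p′ (λ j → ∑ q (λ r → fromℕ r * below j r) + ∑i (ℕ.suc (h (ℕ.suc j))))
    ≡⟨ ∑-cong p′ (λ j j<p′ → ∑i-split (h (ℕ.suc j)) q (h<q (ℕ.suc j) (ℕ.s≤s j<p′))) ⟩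
  ∑ p′ (λ _ → ∑i q)
    ≡⟨ ∑-const p′ (∑i q) ⟩
  fromℕ p′ * ∑i q
    ∎
  where
  open ≡-Reasoning
  p : ℕ
  p = ℕ.suc p′
  h : ℕ → ℕ
  h j = (j ℕ.* q) ℕ./ p
  below : ℕ → ℕ → ℚ
  below j r = 𝟙 (h (ℕ.suc j) ℕ.<? r)
  B′ : ℚ
  B′ = ∑ p′ (λ j → ∑i (ℕ.suc (h (ℕ.suc j))))
  h<q : ∀ j → j < p → h j < q
  h<q j j<p = ℕ.m<n*o⇒m/o<n (subst (j ℕ.* q <_) (ℕ.*-comm p q) (ℕ.*-monoˡ-< q j<p))

∑i-residues : ∀ p q .{{_ : NonZero p}} → Coprime p q →
  ∑i p ≡ fromℕ q * ∑i p - fromℕ p * ∑ p (λ j → fromℕ ((j ℕ.* q) ℕ./ p))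
∑i-residues p q coprime = begin
  ∑i p                                          ≡⟨ ∑-permute-mod p q coprime fromℕ ⟨
  ∑ p (λ j → fromℕ ((j ℕ.* q) ℕ.% p))           ≡⟨ ∑-cong p (λ j _ → trans (fromℕ-*-% j q p) (regroup (fromℕ j) Q P (H j))) ⟩
  ∑ p (λ j → Q * fromℕ j + (- P) * H j)         ≡⟨ ∑-linear₂ p Q (- P) fromℕ H ⟩
  Q * ∑i p + (- P) * ∑ p H                      ≡⟨ algebra Q P (∑i p) (∑ p H) ⟩
  Q * ∑i p - P * ∑ p H                          ∎
  where
  open ≡-Reasoning
  P Q : ℚ
  P = fromℕ p
  Q = fromℕ q
  H : ℕ → ℚ
  H j = fromℕ ((j ℕ.* q) ℕ./ p)
  regroup : ∀ J Q P H → J * Q - H * P ≡ Q * J + (- P) * H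
  regroup = solve-∀ ℚ-ring
  algebra : ∀ Q P S T → Q * S + (- P) * T ≡ Q * S - P * T
  algebra = solve-∀ ℚ-ring

∑i²-residues : ∀ p q .{{_ : NonZero p}} → Coprime p q →
  ∑i² p ≡ fromℕ q * fromℕ q * ∑i² p
          - fromℕ 2 * fromℕ p * fromℕ q * ∑ p (λ j → fromℕ j * fromℕ ((j ℕ.* q) ℕ./ p))
          + fromℕ p * fromℕ p * ∑ p (λ j → fromℕ ((j ℕ.* q) ℕ./ p) * fromℕ ((j ℕ.* q) ℕ./ p))
∑i²-residues p q coprime = begin
  ∑i² p                                                   ≡⟨ ∑-permute-mod p q coprime (λ y → fromℕ y * fromℕ y) ⟨
  ∑ p (λ j → Y j * Y j)                                   ≡⟨ ∑-cong p (λ j _ → trans (cong₂ _*_ (fromℕ-*-% j q p) (fromℕ-*-% j q p))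
                                                                                     (square (fromℕ j) Q P (H j))) ⟩
  ∑ p (λ j → Q * Q * (fromℕ j * fromℕ j) + (- (fromℕ 2 * P * Q)) * (fromℕ j * H j) + P * P * (H j * H j))
                                                          ≡⟨ ∑-linear₃ p (Q * Q) (- (fromℕ 2 * P * Q)) (P * P)
                                                               (λ j → fromℕ j * fromℕ j) (λ j → fromℕ j * H j) (λ j → H j * H j) ⟩
  Q * Q * ∑i² p + (- (fromℕ 2 * P * Q)) * ∑ p (λ j → fromℕ j * H j) + P * P * ∑ p (λ j → H j * H j)
                                                          ≡⟨ algebra P Q (∑i² p) _ _ ⟩
  Q * Q * ∑i² p - fromℕ 2 * P * Q * ∑ p (λ j → fromℕ j * H j) + P * P * ∑ p (λ j → H j * H j)
                                                          ∎
  where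
  open ≡-Reasoning
  P Q : ℚ
  P = fromℕ p
  Q = fromℕ q
  H Y : ℕ → ℚ
  H j = fromℕ ((j ℕ.* q) ℕ./ p)
  Y j = fromℕ ((j ℕ.* q) ℕ.% p)
  square : ∀ J Q P H → (J * Q - H * P) * (J * Q - H * P) ≡ Q * Q * (J * J) + (- (fromℕ 2 * P * Q)) * (J * H) + P * P * (H * H)
  square = solve-∀ ℚ-ring
  algebra : ∀ P Q S U V → Q * Q * S + (- (fromℕ 2 * P * Q)) * U + P * P * V ≡ Q * Q * S - fromℕ 2 * P * Q * U + P * P * V
  algebra = solve-∀ ℚ-ring

-- Reciprocity

-- Here Tₙ = Σ_{i<n} i, Sₙ = Σ_{i<n} i², A = Σ_{r<q} r⌊rp/q⌋, B = Σ_{j<p} T(⌊jq/p⌋ + 1),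
-- C = Σ_{j<p} j⌊jq/p⌋ and Hₖ = Σ_{j<p} ⌊jq/p⌋ᵏ; D_pq and D_qp are the Dedekind numerators.
reciprocity-algebra : ∀ {P P′ Q A B C H₁ H₂ Tp Tq Sp Sq Dpq Dqp : ℚ} →
  P ≡ 1ℚ + P′ →
  Tp ≡ + 1 ÷ℕ 2 * (P * P - P) →
  Tq ≡ + 1 ÷ℕ 2 * (Q * Q - Q) →
  Sp ≡ + 1 ÷ℕ 6 * (fromℕ 2 * (P * P * P) - fromℕ 3 * (P * P) + P) →
  Sq ≡ + 1 ÷ℕ 6 * (fromℕ 2 * (Q * Q * Q) - fromℕ 3 * (Q * Q) + Q) →
  Dpq ≡ P * Sq - Q * A →
  Dqp ≡ Q * Sp - P * C →
  B ≡ + 1 ÷ℕ 2 * H₂ + + 1 ÷ℕ 2 * H₁ →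
  A + B ≡ P′ * Tq →
  Tp ≡ Q * Tp - P * H₁ →
  Sp ≡ Q * Q * Sp - fromℕ 2 * P * Q * C + P * P * H₂ →
  fromℕ 12 * P * P * Dpq + fromℕ 12 * Q * Q * Dqp ≡
    fromℕ 3 * (P * P * P * Q * Q) + P * P * P * Q + fromℕ 3 * (P * P * Q * Q * Q)
    - fromℕ 9 * (P * P * Q * Q) + P * Q * Q * Q + P * Q
reciprocity-algebra {P′ = P′} {Q} {A} {C = C} {H₁} {H₂} refl refl refl refl refl refl refl refl lattice residues residues² =
  ≡-modulo (- (fromℕ 12 * (1ℚ + P′) * (1ℚ + P′) * Q)) lattice
    (≡-modulo (- (fromℕ 6 * Q)) residues²
      (≡-modulo (fromℕ 6 * (1ℚ + P′) * Q) residues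
        (solve (P′ ∷ Q ∷ A ∷ C ∷ H₁ ∷ H₂ ∷ []) ℚ-ring)))

dedekindNumerator-reciprocity : ∀ p q .{{_ : NonZero p}} .{{_ : NonZero q}} → Coprime p q →
  let P = fromℕ p ; Q = fromℕ q in
  fromℕ 12 * P * P * dedekindNumerator p q + fromℕ 12 * Q * Q * dedekindNumerator q p ≡
    fromℕ 3 * (P * P * P * Q * Q) + P * P * P * Q + fromℕ 3 * (P * P * Q * Q * Q)
    - fromℕ 9 * (P * P * Q * Q) + P * Q * Q * Q + P * Q
dedekindNumerator-reciprocity p@(ℕ.suc p′) q coprime =
  reciprocity-algebra {A = ∑ q (λ r → fromℕ r * fromℕ ((r ℕ.* p) ℕ./ q))} {C = ∑ p (λ j → fromℕ j * H j)}
                      {H₁ = ∑ p H} {H₂ = ∑ p (λ j → H j * H j)}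
  (fromℕ-+ 1 p′)
  (∑i-closed p) (∑i-closed q) (∑i²-closed p) (∑i²-closed q)
  (dedekindNumerator-floor p q) (dedekindNumerator-floor q p)
  (∑-∑i-suc p (λ j → (j ℕ.* q) ℕ./ p))
  (lattice-count p′ q coprime)
  (∑i-residues p q coprime) (∑i²-residues p q coprime)
  where
  H : ℕ → ℚ
  H j = fromℕ ((j ℕ.* q) ℕ./ p)

reciprocity-clearing : ∀ {P Q S₁ S₂ D₁ D₂ X Y : ℚ} →
  S₁ * (Q * Q) ≡ D₁ →
  S₂ * (P * P) ≡ D₂ →
  fromℕ 12 * P * P * D₁ + fromℕ 12 * Q * Q * D₂ ≡
    fromℕ 3 * (P * P * P * Q * Q) + P * P * P * Q + fromℕ 3 * (P * P * Q * Q * Q)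
    - fromℕ 9 * (P * P * Q * Q) + P * Q * Q * Q + P * Q →
  X * (fromℕ 12 * P * Q) ≡ P * P + Q * Q + 1ℚ →
  Y * fromℕ 4 ≡ P + Q →
  (S₁ + S₂) * (fromℕ 12 * P * P * Q * Q) ≡ (X + Y - + 3 ÷ℕ 4) * (fromℕ 12 * P * P * Q * Q)
reciprocity-clearing {P} {Q} {S₁} {S₂} {X = X} {Y} refl refl numerators X-cleared Y-cleared =
  ≡-modulo 1ℚ numerators
    (≡-modulo (- (P * Q)) X-cleared
      (≡-modulo (- (fromℕ 3 * P * Q * P * Q)) Y-cleared
        (solve (P ∷ Q ∷ S₁ ∷ S₂ ∷ X ∷ Y ∷ []) ℚ-ring)))

dedekind-reciprocity : ∀ p q .{{_ : NonZero p}} .{{_ : NonZero q}} → Coprime p q →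
  dedekind (+ p) q + dedekind (+ q) p ≡
    + (p ℕ.* p ℕ.+ q ℕ.* q ℕ.+ 1) ÷ℕ (12 ℕ.* p ℕ.* q) + + (p ℕ.+ q) ÷ℕ 4 - + 3 ÷ℕ 4
dedekind-reciprocity p@(ℕ.suc _) q@(ℕ.suc _) coprime = *-cancelʳ-≡ _ _ (fromℕ (12 ℕ.* p ℕ.* p ℕ.* q ℕ.* q)) (begin
  (S₁ + S₂) * fromℕ (12 ℕ.* p ℕ.* p ℕ.* q ℕ.* q)   ≡⟨ cong ((S₁ + S₂) *_) fromℕ-c ⟩
  (S₁ + S₂) * (fromℕ 12 * P * P * Q * Q)           ≡⟨ reciprocity-clearing {P} {Q} {S₁} {S₂} {X = X} {Y} (dedekind-numerator p q) (dedekind-numerator q p)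
                                                        (dedekindNumerator-reciprocity p q coprime) X-cleared Y-cleared ⟩
  (X + Y - + 3 ÷ℕ 4) * (fromℕ 12 * P * P * Q * Q)  ≡⟨ cong ((X + Y - + 3 ÷ℕ 4) *_) fromℕ-c ⟨
  (X + Y - + 3 ÷ℕ 4) * fromℕ (12 ℕ.* p ℕ.* p ℕ.* q ℕ.* q) ∎)
  where
  open ≡-Reasoning
  P Q S₁ S₂ X Y : ℚ
  P = fromℕ p
  Q = fromℕ q
  S₁ = dedekind (+ p) q
  S₂ = dedekind (+ q) p
  X = + (p ℕ.* p ℕ.+ q ℕ.* q ℕ.+ 1) ÷ℕ (12 ℕ.* p ℕ.* q)
  Y = + (p ℕ.+ q) ÷ℕ 4
  fromℕ-c : fromℕ (12 ℕ.* p ℕ.* p ℕ.* q ℕ.* q) ≡ fromℕ 12 * P * P * Q * Q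
  fromℕ-c = trans (fromℕ-* (12 ℕ.* p ℕ.* p ℕ.* q) q) (cong (_* Q)
           (trans (fromℕ-* (12 ℕ.* p ℕ.* p) q) (cong (_* Q)
           (trans (fromℕ-* (12 ℕ.* p) p) (cong (_* P) (fromℕ-* 12 p))))))
  X-cleared : X * (fromℕ 12 * P * Q) ≡ P * P + Q * Q + 1ℚ
  X-cleared = begin
    X * (fromℕ 12 * P * Q)                 ≡⟨ cong (X *_) (trans (fromℕ-* (12 ℕ.* p) q) (cong (_* Q) (fromℕ-* 12 p))) ⟨
    X * fromℕ (12 ℕ.* p ℕ.* q)             ≡⟨ ÷ℕ-*-fromℕ (p ℕ.* p ℕ.+ q ℕ.* q ℕ.+ 1) (12 ℕ.* p ℕ.* q) ⟩
    fromℕ (p ℕ.* p ℕ.+ q ℕ.* q ℕ.+ 1)      ≡⟨ fromℕ-+ (p ℕ.* p ℕ.+ q ℕ.* q) 1 ⟩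
    fromℕ (p ℕ.* p ℕ.+ q ℕ.* q) + 1ℚ       ≡⟨ cong (_+ 1ℚ) (trans (fromℕ-+ (p ℕ.* p) (q ℕ.* q)) (cong₂ _+_ (fromℕ-* p p) (fromℕ-* q q))) ⟩
    P * P + Q * Q + 1ℚ                     ∎
  Y-cleared : Y * fromℕ 4 ≡ P + Q
  Y-cleared = trans (÷ℕ-*-fromℕ (p ℕ.+ q) 4) (fromℕ-+ p q)

-- Reduction to small moduli

coprime-residue : ∀ p q a .{{_ : NonZero p}} → Coprime p q → q ℕ.% p ≡ a ℕ.% p → Coprime a p
coprime-residue p q a coprime q≡a (d∣a , d∣p) =
  coprime (d∣p , ∣n∣m%n⇒∣m d∣p (subst (_ ∣_) (sym q≡a) (%-presˡ-∣ d∣a d∣p)))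

dedekind-residue : ∀ p q a .{{_ : NonZero p}} .{{_ : NonZero q}} .{{_ : NonZero a}} →
  Coprime p q → q ℕ.% p ≡ a ℕ.% p →
  dedekind (+ p) q ≡
    + (p ℕ.* p ℕ.+ q ℕ.* q ℕ.+ 1) ÷ℕ (12 ℕ.* p ℕ.* q) + + q ÷ℕ 4
    - + p ÷ℕ (12 ℕ.* a) - + (a ℕ.* a ℕ.+ 1) ÷ℕ (12 ℕ.* a ℕ.* p) - + a ÷ℕ 4
    + dedekind (+ p) a
dedekind-residue p q a coprime q≡a = begin
  dedekind (+ p) q
    ≡⟨ x+y≡z⇒x≡z-y (dedekind-reciprocity p q coprime) ⟩
  X + + (p ℕ.+ q) ÷ℕ 4 - ¾ - dedekind (+ q) p
    ≡⟨ cong (_-_ (X + + (p ℕ.+ q) ÷ℕ 4 - ¾)) (trans same-residue (x+y≡z⇒x≡z-y (dedekind-reciprocity a p coprime′))) ⟩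
  X + + (p ℕ.+ q) ÷ℕ 4 - ¾ - (+ (a ℕ.* a ℕ.+ p ℕ.* p ℕ.+ 1) ÷ℕ (12 ℕ.* a ℕ.* p) + + (a ℕ.+ p) ÷ℕ 4 - ¾ - S)
    ≡⟨ cong₃ (λ u v w → X + u - ¾ - (v + w - ¾ - S)) (÷ℕ-distrib-+ p q 4) split-p² (÷ℕ-distrib-+ a p 4) ⟩
  X + (+ p ÷ℕ 4 + + q ÷ℕ 4) - ¾ - (V + W + (+ a ÷ℕ 4 + + p ÷ℕ 4) - ¾ - S)
    ≡⟨ algebra X (+ p ÷ℕ 4) (+ q ÷ℕ 4) ¾ V W (+ a ÷ℕ 4) S ⟩
  X + + q ÷ℕ 4 - W - V - + a ÷ℕ 4 + S
    ∎
  where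
  open ≡-Reasoning
  X V W S ¾ : ℚ
  X = + (p ℕ.* p ℕ.+ q ℕ.* q ℕ.+ 1) ÷ℕ (12 ℕ.* p ℕ.* q)
  V = + (a ℕ.* a ℕ.+ 1) ÷ℕ (12 ℕ.* a ℕ.* p)
  W = + p ÷ℕ (12 ℕ.* a)
  S = dedekind (+ p) a
  ¾ = + 3 ÷ℕ 4
  coprime′ : Coprime a p
  coprime′ = coprime-residue p q a coprime q≡a
  same-residue : dedekind (+ q) p ≡ dedekind (+ a) p
  same-residue = trans (dedekind-mod q p) (trans (cong (λ r → dedekind (+ r) p) q≡a) (sym (dedekind-mod a p)))
  cong₃ : ∀ (f : ℚ → ℚ → ℚ → ℚ) {u u′ v v′ w w′} → u ≡ u′ → v ≡ v′ → w ≡ w′ → f u v w ≡ f u′ v′ w′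
  cong₃ f refl refl refl = refl
  regroup : ∀ a p → a ℕ.* a ℕ.+ p ℕ.* p ℕ.+ 1 ≡ a ℕ.* a ℕ.+ 1 ℕ.+ p ℕ.* p
  regroup = ℕ.solve-∀
  split-p² : + (a ℕ.* a ℕ.+ p ℕ.* p ℕ.+ 1) ÷ℕ (12 ℕ.* a ℕ.* p) ≡ V + W
  split-p² = begin
    + (a ℕ.* a ℕ.+ p ℕ.* p ℕ.+ 1) ÷ℕ (12 ℕ.* a ℕ.* p)   ≡⟨ cong (λ m → + m ÷ℕ (12 ℕ.* a ℕ.* p)) (regroup a p) ⟩
    + (a ℕ.* a ℕ.+ 1 ℕ.+ p ℕ.* p) ÷ℕ (12 ℕ.* a ℕ.* p)   ≡⟨ ÷ℕ-distrib-+ (a ℕ.* a ℕ.+ 1) (p ℕ.* p) (12 ℕ.* a ℕ.* p) ⟩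
    V + + (p ℕ.* p) ÷ℕ (12 ℕ.* a ℕ.* p)                 ≡⟨ cong (_+_ V) (÷ℕ-cancelʳ p (12 ℕ.* a) p {{ℕ.m*n≢0 12 a}}) ⟩
    V + W                                               ∎
  algebra : ∀ X u y t V W v S → X + (u + y) - t - (V + W + (v + u) - t - S) ≡ X + y - W - V - v + S
  algebra = solve-∀ ℚ-ring

dedekind-by-residue : ∀ p a .{{_ : NonZero a}} (f : ℚ → ℚ) → Coprime a p →
  (∀ r → r < a → Coprime a r → dedekind (+ r) a ≡ f (+ r ÷ℕ a)) →
  dedekind (+ p) a ≡ f (frac (+ p ÷ℕ a))
dedekind-by-residue p a f coprime table = begin
  dedekind (+ p) a             ≡⟨ dedekind-mod p a ⟩
  dedekind (+ (p ℕ.% a)) a     ≡⟨ table (p ℕ.% a) (ℕ.m%n<n p a) coprime-rem ⟩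
  f (+ (p ℕ.% a) ÷ℕ a)         ≡⟨ cong f (frac-÷ℕ p a) ⟨
  f (frac (+ p ÷ℕ a))          ∎
  where
  open ≡-Reasoning
  coprime-rem : Coprime a (p ℕ.% a)
  coprime-rem = Coprime.sym (coprime-residue a p (p ℕ.% a) coprime (sym (ℕ.m%n%n≡m%n p a)))

dedekind[p,2] : ∀ p → Coprime 2 p → dedekind (+ p) 2 ≡ + 1 ÷ℕ 4
dedekind[p,2] p coprime = dedekind-by-residue p 2 (λ _ → + 1 ÷ℕ 4) coprime table
  where
  table : ∀ r → r < 2 → Coprime 2 r → dedekind (+ r) 2 ≡ + 1 ÷ℕ 4
  table 0 _ c = ⊥-elim (¬0-coprimeTo-2+ (Coprime.sym c))
  table 1 _ _ = refl
  table (ℕ.suc (ℕ.suc _)) (ℕ.s≤s (ℕ.s≤s ())) _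

dedekind[p,3] : ∀ p → Coprime 3 p → dedekind (+ p) 3 ≡ + 2 ÷ℕ 3 - + 1 ÷ℕ 3 * frac (+ p ÷ℕ 3)
dedekind[p,3] p coprime = dedekind-by-residue p 3 (λ t → + 2 ÷ℕ 3 - + 1 ÷ℕ 3 * t) coprime table
  where
  table : ∀ r → r < 3 → Coprime 3 r → dedekind (+ r) 3 ≡ + 2 ÷ℕ 3 - + 1 ÷ℕ 3 * (+ r ÷ℕ 3)
  table 0 _ c = ⊥-elim (¬0-coprimeTo-2+ (Coprime.sym c))
  table 1 _ _ = refl
  table 2 _ _ = refl
  table (ℕ.suc (ℕ.suc (ℕ.suc _))) (ℕ.s≤s (ℕ.s≤s (ℕ.s≤s ()))) _

dedekind[p,4] : ∀ p → Coprime 4 p → dedekind (+ p) 4 ≡ 1ℚ - + 1 ÷ℕ 2 * frac (+ p ÷ℕ 4)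
dedekind[p,4] p coprime = dedekind-by-residue p 4 (λ t → 1ℚ - + 1 ÷ℕ 2 * t) coprime table
  where
  table : ∀ r → r < 4 → Coprime 4 r → dedekind (+ r) 4 ≡ 1ℚ - + 1 ÷ℕ 2 * (+ r ÷ℕ 4)
  table 0 _ c = ⊥-elim (¬0-coprimeTo-2+ (Coprime.sym c))
  table 1 _ _ = refl
  table 2 _ c = contradiction (c (divides 2 refl , divides 1 refl)) (λ ())
  table 3 _ _ = refl
  table (ℕ.suc (ℕ.suc (ℕ.suc (ℕ.suc _)))) (ℕ.s≤s (ℕ.s≤s (ℕ.s≤s (ℕ.s≤s ())))) _

module _ (p q : ℕ) .{{_ : NonZero p}} .{{_ : NonZero q}} (coprime : Coprime p q) where

  private
    X : ℚ
    X = + (p ℕ.* p ℕ.+ q ℕ.* q ℕ.+ 1) ÷ℕ (12 ℕ.* p ℕ.* q)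

    halve : ∀ m c .{{_ : NonZero c}} → + (m ℕ.* 2) ÷ℕ ((c ℕ.+ c) ℕ.* p) ≡ + m ÷ℕ (c ℕ.* p)
    halve m c = trans (cong (λ d → + (m ℕ.* 2) ÷ℕ d) (double c p)) (÷ℕ-cancelʳ m (c ℕ.* p) 2 {{ℕ.m*n≢0 c p}})
      where
      double : ∀ c p → (c ℕ.+ c) ℕ.* p ≡ c ℕ.* p ℕ.* 2
      double = ℕ.solve-∀

  dedekind-q≡1 : q ℕ.% p ≡ 1 ℕ.% p →
    dedekind (+ p) q ≡ X + + q ÷ℕ 4 - + p ÷ℕ 12 - + 1 ÷ℕ (6 ℕ.* p) - + 1 ÷ℕ 4
  dedekind-q≡1 q≡1 = begin
    dedekind (+ p) q                                                    ≡⟨ dedekind-residue p q 1 coprime q≡1 ⟩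
    X + + q ÷ℕ 4 - + p ÷ℕ 12 - + 2 ÷ℕ (12 ℕ.* p) - + 1 ÷ℕ 4 + 0ℚ      ≡⟨ +-identityʳ _ ⟩
    X + + q ÷ℕ 4 - + p ÷ℕ 12 - + 2 ÷ℕ (12 ℕ.* p) - + 1 ÷ℕ 4           ≡⟨ cong (λ v → X + + q ÷ℕ 4 - + p ÷ℕ 12 - v - + 1 ÷ℕ 4) (halve 1 6) ⟩
    X + + q ÷ℕ 4 - + p ÷ℕ 12 - + 1 ÷ℕ (6 ℕ.* p) - + 1 ÷ℕ 4           ∎
    where open ≡-Reasoning

  dedekind-q≡2 : q ℕ.% p ≡ 2 ℕ.% p →
    dedekind (+ p) q ≡ X + + q ÷ℕ 4 - + p ÷ℕ 24 - + 5 ÷ℕ (24 ℕ.* p) - + 1 ÷ℕ 4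
  dedekind-q≡2 q≡2 = begin
    dedekind (+ p) q                         ≡⟨ dedekind-residue p q 2 coprime q≡2 ⟩
    w - + 2 ÷ℕ 4 + dedekind (+ p) 2          ≡⟨ cong (_+_ (w - + 2 ÷ℕ 4)) (dedekind[p,2] p (coprime-residue p q 2 coprime q≡2)) ⟩
    w - + 2 ÷ℕ 4 + + 1 ÷ℕ 4                  ≡⟨ algebra w ⟩
    w - + 1 ÷ℕ 4                             ∎
    where
    open ≡-Reasoning
    w : ℚ
    w = X + + q ÷ℕ 4 - + p ÷ℕ 24 - + 5 ÷ℕ (24 ℕ.* p)
    algebra : ∀ w → w - + 2 ÷ℕ 4 + + 1 ÷ℕ 4 ≡ w - + 1 ÷ℕ 4
    algebra = solve-∀ ℚ-ring

  dedekind-q≡3 : q ℕ.% p ≡ 3 ℕ.% p →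
    dedekind (+ p) q ≡ X + + q ÷ℕ 4 - + p ÷ℕ 36 - + 5 ÷ℕ (18 ℕ.* p) - + 1 ÷ℕ 3 * frac (+ p ÷ℕ 3) - + 1 ÷ℕ 12
  dedekind-q≡3 q≡3 = begin
    dedekind (+ p) q                                                   ≡⟨ dedekind-residue p q 3 coprime q≡3 ⟩
    X + + q ÷ℕ 4 - + p ÷ℕ 36 - + 10 ÷ℕ (36 ℕ.* p) - + 3 ÷ℕ 4 + dedekind (+ p) 3
                                                                       ≡⟨ cong₂ (λ v S → X + + q ÷ℕ 4 - + p ÷ℕ 36 - v - + 3 ÷ℕ 4 + S)
                                                                            (halve 5 18) (dedekind[p,3] p (coprime-residue p q 3 coprime q≡3)) ⟩
    w - + 3 ÷ℕ 4 + (+ 2 ÷ℕ 3 - + 1 ÷ℕ 3 * F)                           ≡⟨ algebra w F ⟩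
    w - + 1 ÷ℕ 3 * F - + 1 ÷ℕ 12                                       ∎
    where
    open ≡-Reasoning
    w : ℚ
    w = X + + q ÷ℕ 4 - + p ÷ℕ 36 - + 5 ÷ℕ (18 ℕ.* p)
    F : ℚ
    F = frac (+ p ÷ℕ 3)
    algebra : ∀ w F → w - + 3 ÷ℕ 4 + (+ 2 ÷ℕ 3 - + 1 ÷ℕ 3 * F) ≡ w - + 1 ÷ℕ 3 * F - + 1 ÷ℕ 12
    algebra = solve-∀ ℚ-ring

  dedekind-q≡4 : q ℕ.% p ≡ 4 ℕ.% p →
    dedekind (+ p) q ≡ X + + q ÷ℕ 4 - + p ÷ℕ 48 - + 17 ÷ℕ (48 ℕ.* p) - + 1 ÷ℕ 2 * frac (+ p ÷ℕ 4)
  dedekind-q≡4 q≡4 = begin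
    dedekind (+ p) q                         ≡⟨ dedekind-residue p q 4 coprime q≡4 ⟩
    w - + 4 ÷ℕ 4 + dedekind (+ p) 4          ≡⟨ cong (_+_ (w - + 4 ÷ℕ 4)) (dedekind[p,4] p (coprime-residue p q 4 coprime q≡4)) ⟩
    w - + 4 ÷ℕ 4 + (1ℚ - + 1 ÷ℕ 2 * F)       ≡⟨ algebra w F ⟩
    w - + 1 ÷ℕ 2 * F                         ∎
    where
    open ≡-Reasoning
    w : ℚ
    w = X + + q ÷ℕ 4 - + p ÷ℕ 48 - + 17 ÷ℕ (48 ℕ.* p)
    F : ℚ
    F = frac (+ p ÷ℕ 4)
    algebra : ∀ w F → w - + 4 ÷ℕ 4 + (1ℚ - + 1 ÷ℕ 2 * F) ≡ w - + 1 ÷ℕ 2 * F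
    algebra = solve-∀ ℚ-ring

-- The hypothesis p < q is only used to know that q is nonzero.
theorem2 : (p q : ℕ) → .{{_ : NonZero p}} → p < q → Coprime p q →
    ((q % p ≡ 1 % p →
       dedekind (+ p) q ≡
         + (p ℕ.* p ℕ.+ q ℕ.* q ℕ.+ 1) ÷ℕ (12 ℕ.* p ℕ.* q) + + q ÷ℕ 4
         - + p ÷ℕ 12 - + 1 ÷ℕ (6 ℕ.* p) - + 1 ÷ℕ 4)
    × (q % p ≡ 2 % p →
       dedekind (+ p) q ≡
         + (p ℕ.* p ℕ.+ q ℕ.* q ℕ.+ 1) ÷ℕ (12 ℕ.* p ℕ.* q) + + q ÷ℕ 4
         - + p ÷ℕ 24 - + 5 ÷ℕ (24 ℕ.* p) - + 1 ÷ℕ 4)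
    × (q % p ≡ 3 % p →
       dedekind (+ p) q ≡
         + (p ℕ.* p ℕ.+ q ℕ.* q ℕ.+ 1) ÷ℕ (12 ℕ.* p ℕ.* q) + + q ÷ℕ 4
         - + p ÷ℕ 36 - + 5 ÷ℕ (18 ℕ.* p) - + 1 ÷ℕ 3 * frac (+ p ÷ℕ 3)
         - + 1 ÷ℕ 12)
    × (q % p ≡ 4 % p →
       dedekind (+ p) q ≡
         + (p ℕ.* p ℕ.+ q ℕ.* q ℕ.+ 1) ÷ℕ (12 ℕ.* p ℕ.* q) + + q ÷ℕ 4
         - + p ÷ℕ 48 - + 17 ÷ℕ (48 ℕ.* p) - + 1 ÷ℕ 2 * frac (+ p ÷ℕ 4)))
theorem2 p q@(ℕ.suc _) _ coprime =
  dedekind-q≡1 p q coprime , dedekind-q≡2 p q coprime , dedekind-q≡3 p q coprime , dedekind-q≡4 p q coprime
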